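{- Let $q\ge2$, $n\ge1$, $I\subseteq\{1,\ldots,n\}$, and let $f:\mathbb{F}_q^n\to\mathbb{C}$ be an arbitrary function. Then $$g^I_f(x,y)=q^{ -n}\sum_{\beta\in\mathbb{F}_q^n}\widehat{f}(\beta)\,(x+(q-1)y)^{|I|-|I\cap s(\beta)|}\,(x-y)^{|I\cap s(\beta)|}.$$
   Context: $\mathbb{F}_q=\{0,\ldots,q-1\}$ is the group of integers modulo $q$. For $\alpha\in\mathbb{F}_q^n$, $s(\alpha)$ is the set of nonzero coordinates. $\Gamma_I=\{\alpha\in\mathbb{F}_q^n:\alpha_i=0\ \forall i\notin I\}$. The local weight enumerator of $f$ in $\Gamma_I$ (with respect to the zero vertex) is $g^I_f(x,y)=\sum_{\beta\in\Gamma_I}f(\beta)\,y^{|s(\beta)|}x^{|I|-|s(\beta)|}$. With $\xi=e^{2\pi\sqrt{ -1}/q}$ and $\langle\alpha,\beta\rangle=\sum_i\alpha_i\beta_i\bmod q$, the Fourier transform is $\widehat{f}(\alpha)=\sum_{\beta\in\mathbb{F}_q^n} f(\beta)\,\overline{\xi^{\langle\alpha,\beta\rangle}}$. -}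

module Defs where

open import Level using (Level)
open import Algebra.Bundles using (CommutativeRing)
import Algebra.Bundles
open import Data.Nat using (ℕ; zero; suc; _∸_; NonZero)
open import Data.Nat.DivMod using (_%_)
import Data.Nat as N
open import Data.Fin using (Fin; toℕ)
open import Data.Fin.Subset using (Subset; inside; outside)
open import Data.Bool using (Bool; true; false; if_then_else_; _∧_)
open import Data.List using (List; []; _∷_; map; concatMap; allFin; foldr; length; filterᵇ)
open import Data.Vec using (lookup)
import Data.Vec.Functional as VF

-- 𝔽_q^n is modelled as functions Fin n → Fin q (integers modulo q).
Vec𝔽 : ℕ → ℕ → Set
Vec𝔽 q n = Fin n → Fin q

allVecs : (q n : ℕ) → List (Vec𝔽 q n)
allVecs q zero    = (λ ()) ∷ []
allVecs q (suc n) = concatMap (λ a → map (λ v → a VF.∷ v) (allVecs q n)) (allFin q)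

nz : {q : ℕ} → Fin q → Bool
nz Fin.zero    = false
nz (Fin.suc _) = true

inI : {n : ℕ} → Subset n → Fin n → Bool
inI I i with lookup I i
... | inside  = true
... | outside = false

wt : {q n : ℕ} → Vec𝔽 q n → ℕ
wt {n = n} β = length (filterᵇ (λ i → nz (β i)) (allFin n))

wtI : {q n : ℕ} → Subset n → Vec𝔽 q n → ℕ
wtI {n = n} I β = length (filterᵇ (λ i → inI I i ∧ nz (β i)) (allFin n))

inΓ : {q n : ℕ} → Subset n → Vec𝔽 q n → Bool
inΓ {n = n} I β = foldr (λ i b → (if inI I i then true else (if nz (β i) then false else true)) ∧ b) true (allFin n)

inner : (q : ℕ) .{{_ : NonZero q}} {n : ℕ} → Vec𝔽 q n → Vec𝔽 q n → ℕ
inner q {n} α β = foldr (λ i s → toℕ (α i) N.* toℕ (β i) N.+ s) 0 (allFin n) % q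

module Over {c ℓ : Level} (R : CommutativeRing c ℓ) where
  open CommutativeRing R
  open import Algebra.Definitions.RawSemiring (Algebra.Bundles.Semiring.rawSemiring semiring) using (_^_; _×_) public

  Σl : {A : Set} → List A → (A → Carrier) → Carrier
  Σl xs t = foldr (λ a s → t a + s) 0# xs

  Σ𝔽 : (q n : ℕ) → (Vec𝔽 q n → Carrier) → Carrier
  Σ𝔽 q n = Σl (allVecs q n)

  localWE : (q n : ℕ) → Subset n → (Vec𝔽 q n → Carrier) → Carrier → Carrier → Carrier
  localWE q n I f x y =
    Σ𝔽 q n (λ β → if inΓ I β
                    then f β * (y ^ wt β) * (x ^ (Data.Fin.Subset.∣ I ∣ ∸ wt β))
                    else 0#)

  -- Fourier transform with respect to ξ: conj(ξ^k) = ξ^{-k} = ξ^{q - k}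
  -- (for a q-th root of unity ξ of modulus 1, as ξ = e^{2πi/q} in ℂ)
  fourier : (ξ : Carrier) (q : ℕ) .{{_ : NonZero q}} (n : ℕ) → (Vec𝔽 q n → Carrier) → Vec𝔽 q n → Carrier
  fourier ξ q n f α = Σ𝔽 q n (λ β → f β * ξ ^ (q ∸ inner q α β))

module Submission where

-- Write U = x + (q-1) y, V = x - y, ζ = ξ^(q-1) = ξ̄, and let χ(b,c) = ζ^(bc)
-- for b c ∈ 𝔽_q.  Everything factorises over the coordinates of 𝔽_q^n:
--   * the Fourier kernel ξ̄^⟨β,γ⟩ is the product of the χ(β_i, γ_i);
--   * the weight monomial U^(|I|-|I∩s(β)|) V^(|I∩s(β)|) is the product of
--     coordinate factors (U or V on I according as β_i = 0, and 1 off I);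
--   * the Γ_I-term [γ ∈ Γ_I] y^|s(γ)| x^(|I|-|s(γ)|) of g^I_f is the product
--     of coordinate factors (x or y on I, and [γ_i = 0] off I).
-- By orthogonality of characters (Σ_b ζ^(bc) = q [c = 0], which uses that ζ
-- is a primitive q-th root of unity in an integral domain), the transform of
-- one coordinate factor of the weight monomial is q times the corresponding
-- Γ_I-factor.  Since the sum of a product over 𝔽_q^n is the product of the
-- coordinate sums, Σ_β ξ̄^⟨β,γ⟩ (weight monomial of β) = q^n (Γ_I-term of γ),
-- and the theorem follows by exchanging the sums over β and γ.

open import Defs
open import Level using (Level)
open import Algebra.Bundles using (CommutativeRing)
open import Algebra.Bundles using (Semiring)
open import Data.Nat using (ℕ; suc; _∸_; _≤_; _<_; NonZero)
open import Data.Fin.Subset using (Subset; ∣_∣)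
open import Data.Sum using (_⊎_)
open import Relation.Nullary using (¬_)

open import Data.Nat as ℕ using (zero; z≤n; s≤s)
import Data.Nat.Properties as ℕ
open import Data.Nat.DivMod using (_%_; _/_; m%n<n; m≡m%n+[m/n]*n)
open import Data.Fin using (Fin; toℕ)
open import Data.Fin.Properties using (toℕ<n)
open import Data.Fin.Subset using (inside; outside)
open import Data.Bool using (Bool; true; false; if_then_else_; _∧_)
open import Data.List using (List; []; _∷_; map; concatMap; allFin; foldr; length; filterᵇ; tabulate; _++_; lookup)
open import Data.Vec using ([]; _∷_)
import Data.Vec
import Data.Vec.Functional as Vector
open import Data.Sum using (inj₁; inj₂)
open import Data.Empty using (⊥-elim)
open import Function using (_∘_)
open import Relation.Binary.PropositionalEquality using (_≡_; refl; cong; module ≡-Reasoning)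
import Relation.Binary.PropositionalEquality as ≡

-- Counting coordinates: the number of i : Fin n with p i, and whether all
-- coordinates satisfy p.  These recurse on n, matching products over Fin n.

count : ∀ {n} → (Fin n → Bool) → ℕ
count {zero}  p = 0
count {suc n} p = (if p Fin.zero then 1 else 0) ℕ.+ count (p ∘ Fin.suc)

every : ∀ {n} → (Fin n → Bool) → Bool
every {zero}  p = true
every {suc n} p = p Fin.zero ∧ every (p ∘ Fin.suc)

count-cong : ∀ {n} {p p′ : Fin n → Bool} → (∀ i → p i ≡ p′ i) → count p ≡ count p′
count-cong {zero}  eq = refl
count-cong {suc n} eq = ≡.cong₂ ℕ._+_ (cong (λ b → if b then 1 else 0) (eq Fin.zero)) (count-cong (eq ∘ Fin.suc))

count-∧-≤ : ∀ {n} (p r : Fin n → Bool) → count (λ i → p i ∧ r i) ≤ count p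
count-∧-≤ {zero}  p r = z≤n
count-∧-≤ {suc n} p r with p Fin.zero | r Fin.zero
... | true  | true  = s≤s (count-∧-≤ (p ∘ Fin.suc) (r ∘ Fin.suc))
... | true  | false = ℕ.m≤n⇒m≤1+n (count-∧-≤ (p ∘ Fin.suc) (r ∘ Fin.suc))
... | false | _     = count-∧-≤ (p ∘ Fin.suc) (r ∘ Fin.suc)

length-filter-tabulate : ∀ {A : Set} {n} (p : A → Bool) (f : Fin n → A) →
                         length (filterᵇ p (tabulate f)) ≡ count (p ∘ f)
length-filter-tabulate {n = zero}  p f = refl
length-filter-tabulate {n = suc n} p f with p (f Fin.zero)
... | true  = cong suc (length-filter-tabulate p (f ∘ Fin.suc))
... | false = length-filter-tabulate p (f ∘ Fin.suc)

foldr-∧-tabulate : ∀ {A : Set} {n} (c : A → Bool) (f : Fin n → A) →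
                   foldr (λ a b → c a ∧ b) true (tabulate f) ≡ every (c ∘ f)
foldr-∧-tabulate {n = zero}  c f = refl
foldr-∧-tabulate {n = suc n} c f = cong (c (f Fin.zero) ∧_) (foldr-∧-tabulate c (f ∘ Fin.suc))

inI-suc : ∀ {n} s (I : Subset n) i → inI (s ∷ I) (Fin.suc i) ≡ inI I i
inI-suc s I i with Data.Vec.lookup I i
... | inside  = refl
... | outside = refl

card≡count : ∀ {n} (I : Subset n) → ∣ I ∣ ≡ count (inI I)
card≡count []            = refl
card≡count (inside ∷ I)  = cong suc (≡.trans (card≡count I) (count-cong (λ i → ≡.sym (inI-suc inside I i))))
card≡count (outside ∷ I) = ≡.trans (card≡count I) (count-cong (λ i → ≡.sym (inI-suc outside I i)))

-- A coordinate is admissible for Γ_I when it lies in I (b) or is zero (¬ r);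
-- this is exactly the test performed coordinatewise by inΓ.
admissible : Bool → Bool → Bool
admissible b r = if b then true else (if r then false else true)

inΓ≡every : ∀ {q n} (I : Subset n) (γ : Vec𝔽 q n) → inΓ I γ ≡ every (λ i → admissible (inI I i) (nz (γ i)))
inΓ≡every I γ = foldr-∧-tabulate (λ i → admissible (inI I i) (nz (γ i))) (λ i → i)

count-admissible : ∀ {n} (p r : Fin n → Bool) → every (λ i → admissible (p i) (r i)) ≡ true →
                   count (λ i → p i ∧ r i) ≡ count r
count-admissible {zero}  p r all-adm = refl
count-admissible {suc n} p r all-adm with p Fin.zero | r Fin.zero
... | true  | true  = cong suc (count-admissible (p ∘ Fin.suc) (r ∘ Fin.suc) all-adm)
... | true  | false = count-admissible (p ∘ Fin.suc) (r ∘ Fin.suc) all-adm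
... | false | false = count-admissible (p ∘ Fin.suc) (r ∘ Fin.suc) all-adm
... | false | true  with () ← all-adm

-- Two congruences modulo q = suc q′ needed for q-th roots of unity:
-- q′ k ≡ q - k for k ≤ q, and M ≡ M mod q.
conjugate-exponent : ∀ q′ k → k ≤ suc q′ → q′ ℕ.* k ℕ.+ suc q′ ℕ.* 1 ≡ (suc q′ ∸ k) ℕ.+ suc q′ ℕ.* k
conjugate-exponent q′ k k≤q = begin
    q′ ℕ.* k ℕ.+ suc q′ ℕ.* 1        ≡⟨ cong (q′ ℕ.* k ℕ.+_) (ℕ.*-identityʳ (suc q′)) ⟩
    q′ ℕ.* k ℕ.+ suc q′              ≡⟨ ℕ.+-comm (q′ ℕ.* k) (suc q′) ⟩
    suc q′ ℕ.+ q′ ℕ.* k              ≡⟨ cong (ℕ._+ q′ ℕ.* k) (≡.sym (ℕ.m∸n+n≡m k≤q)) ⟩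
    (suc q′ ∸ k) ℕ.+ k ℕ.+ q′ ℕ.* k  ≡⟨ ℕ.+-assoc (suc q′ ∸ k) k (q′ ℕ.* k) ⟩
    (suc q′ ∸ k) ℕ.+ suc q′ ℕ.* k    ∎
  where open ≡-Reasoning

residue-congruence : ∀ q M .{{_ : NonZero q}} → M ℕ.+ q ℕ.* 0 ≡ M % q ℕ.+ q ℕ.* (M / q)
residue-congruence q M = begin
    M ℕ.+ q ℕ.* 0              ≡⟨ cong (M ℕ.+_) (ℕ.*-zeroʳ q) ⟩
    M ℕ.+ 0                    ≡⟨ ℕ.+-identityʳ M ⟩
    M                          ≡⟨ m≡m%n+[m/n]*n M q ⟩
    M % q ℕ.+ (M / q) ℕ.* q    ≡⟨ cong (M % q ℕ.+_) (ℕ.*-comm (M / q) q) ⟩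
    M % q ℕ.+ q ℕ.* (M / q)    ∎
  where open ≡-Reasoning

module _ {c ℓ : Level} (R : CommutativeRing c ℓ) where
  open CommutativeRing R renaming (refl to ≈-refl)
  open Over R
  open import Relation.Binary.Reasoning.Setoid setoid
  open import Algebra.Definitions.RawSemiring (Semiring.rawSemiring semiring) using (product)
  open import Algebra.Properties.Semiring.Sum semiring using (sum; sum-cong-≋; sum-cong-≗; sum-replicate; ∑-comm; *-distribˡ-sum; *-distribʳ-sum)
  open import Algebra.Properties.CommutativeMonoid.Sum *-commutativeMonoid using ()
    renaming (sum-cong-≋ to product-cong; ∑-distrib-+ to product-distrib-*; sum-replicate to product-replicate)
  open import Algebra.Properties.Semiring.Exp semiring using (^-congˡ; ^-congʳ; ^-homo-*; ^-assocʳ)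
  open import Algebra.Properties.CommutativeSemiring.Exp commutativeSemiring using (^-distrib-*)
  open import Algebra.Properties.Semiring.Mult semiring using (×-congʳ; ×-assoc-*)
  open import Algebra.Properties.CommutativeMonoid.Mult +-commutativeMonoid using (×-distrib-+)
  open import Algebra.Properties.AbelianGroup +-abelianGroup using (⁻¹-anti-homo‿-)
  open import Algebra.Properties.Group +-group using (x∙y⁻¹≈ε⇒x≈y)
  open import Algebra.Properties.Ring ring using (x[y-z]≈xy-xz)
  open import Algebra.Properties.CommutativeSemigroup *-commutativeSemigroup using (x∙yz≈y∙xz)

  Σl-cong : ∀ {A : Set} (xs : List A) {s t : A → Carrier} → (∀ a → s a ≈ t a) → Σl xs s ≈ Σl xs t
  Σl-cong []       eq = ≈-refl
  Σl-cong (x ∷ xs) eq = +-cong (eq x) (Σl-cong xs eq)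

  Σl-++ : ∀ {A : Set} (xs ys : List A) (t : A → Carrier) → Σl (xs ++ ys) t ≈ Σl xs t + Σl ys t
  Σl-++ []       ys t = sym (+-identityˡ _)
  Σl-++ (x ∷ xs) ys t = trans (+-congˡ (Σl-++ xs ys t)) (sym (+-assoc _ _ _))

  Σl-map : ∀ {A B : Set} (g : A → B) (xs : List A) (t : B → Carrier) → Σl (map g xs) t ≈ Σl xs (t ∘ g)
  Σl-map g []       t = ≈-refl
  Σl-map g (x ∷ xs) t = +-congˡ (Σl-map g xs t)

  Σl-concatMap : ∀ {A B : Set} (g : A → List B) (xs : List A) (t : B → Carrier) →
                 Σl (concatMap g xs) t ≈ Σl xs (λ a → Σl (g a) t)
  Σl-concatMap g []       t = ≈-refl
  Σl-concatMap g (x ∷ xs) t = trans (Σl-++ (g x) (concatMap g xs) t) (+-congˡ (Σl-concatMap g xs t))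

  Σl-*ˡ : ∀ {A : Set} (xs : List A) (k : Carrier) (t : A → Carrier) → Σl xs (λ a → k * t a) ≈ k * Σl xs t
  Σl-*ˡ []       k t = sym (zeroʳ k)
  Σl-*ˡ (x ∷ xs) k t = trans (+-congˡ (Σl-*ˡ xs k t)) (sym (distribˡ k _ _))

  Σl-*ʳ : ∀ {A : Set} (xs : List A) (k : Carrier) (t : A → Carrier) → Σl xs (λ a → t a * k) ≈ Σl xs t * k
  Σl-*ʳ xs k t = trans (Σl-cong xs (λ a → *-comm (t a) k)) (trans (Σl-*ˡ xs k t) (*-comm k _))

  Σl≡sum : ∀ {A : Set} (xs : List A) (t : A → Carrier) → Σl xs t ≡ sum (t ∘ lookup xs)
  Σl≡sum []       t = refl
  Σl≡sum (x ∷ xs) t = cong (t x +_) (Σl≡sum xs t)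

  Σl-tabulate : ∀ {A : Set} {n} (f : Fin n → A) (t : A → Carrier) → Σl (tabulate f) t ≡ sum (t ∘ f)
  Σl-tabulate {n = zero}  f t = refl
  Σl-tabulate {n = suc n} f t = cong (t (f Fin.zero) +_) (Σl-tabulate (f ∘ Fin.suc) t)

  Σl-swap : ∀ {A B : Set} (xs : List A) (ys : List B) (t : A → B → Carrier) →
            Σl xs (λ a → Σl ys (t a)) ≈ Σl ys (λ b → Σl xs (λ a → t a b))
  Σl-swap xs ys t = begin
      Σl xs (λ a → Σl ys (t a))
    ≡⟨ ≡.trans (Σl≡sum xs _) (sum-cong-≗ (λ i → Σl≡sum ys (t (lookup xs i)))) ⟩
      sum (λ i → sum (λ j → t (lookup xs i) (lookup ys j)))
    ≈⟨ ∑-comm (λ i j → t (lookup xs i) (lookup ys j)) ⟩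
      sum (λ j → sum (λ i → t (lookup xs i) (lookup ys j)))
    ≡⟨ ≡.sym (≡.trans (Σl≡sum ys _) (sum-cong-≗ (λ j → Σl≡sum xs (λ a → t a (lookup ys j))))) ⟩
      Σl ys (λ b → Σl xs (λ a → t a b))
    ∎

  Σl-transpose : ∀ {A B : Set} (xs : List A) (ys : List B) (f : B → Carrier) (K : A → B → Carrier) (w : A → Carrier) →
                 Σl xs (λ a → Σl ys (λ b → f b * K a b) * w a) ≈ Σl ys (λ b → f b * Σl xs (λ a → K a b * w a))
  Σl-transpose xs ys f K w = begin
      Σl xs (λ a → Σl ys (λ b → f b * K a b) * w a)
    ≈⟨ Σl-cong xs (λ a → trans (sym (Σl-*ʳ ys (w a) _)) (Σl-cong ys (λ b → *-assoc (f b) (K a b) (w a)))) ⟩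
      Σl xs (λ a → Σl ys (λ b → f b * (K a b * w a)))
    ≈⟨ Σl-swap xs ys _ ⟩
      Σl ys (λ b → Σl xs (λ a → f b * (K a b * w a)))
    ≈⟨ Σl-cong ys (λ b → Σl-*ˡ xs (f b) _) ⟩
      Σl ys (λ b → f b * Σl xs (λ a → K a b * w a))
    ∎

  product-scale : ∀ {n} (k : Carrier) (t : Fin n → Carrier) → product (λ i → k * t i) ≈ k ^ n * product t
  product-scale {n} k t = trans (product-distrib-* (λ _ → k) t) (*-congʳ (product-replicate n))

  Σ𝔽-suc : ∀ q n (F : Vec𝔽 q (suc n) → Carrier) → Σ𝔽 q (suc n) F ≈ Σl (allFin q) (λ a → Σ𝔽 q n (λ v → F (a Vector.∷ v)))
  Σ𝔽-suc q n F = trans (Σl-concatMap _ (allFin q) F) (Σl-cong (allFin q) (λ a → Σl-map (a Vector.∷_) (allVecs q n) F))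

  Σ𝔽-product : ∀ q n (k : Fin n → Fin q → Carrier) →
               Σ𝔽 q n (λ β → product (λ i → k i (β i))) ≈ product (λ i → sum (k i))
  Σ𝔽-product q zero    k = +-identityʳ 1#
  Σ𝔽-product q (suc n) k = begin
      Σ𝔽 q (suc n) (λ β → product (λ i → k i (β i)))
    ≈⟨ Σ𝔽-suc q n _ ⟩
      Σl (allFin q) (λ a → Σ𝔽 q n (λ v → k Fin.zero a * product (λ i → k (Fin.suc i) (v i))))
    ≈⟨ Σl-cong (allFin q) (λ a → trans (Σl-*ˡ (allVecs q n) (k Fin.zero a) _) (*-congˡ (Σ𝔽-product q n (k ∘ Fin.suc)))) ⟩
      Σl (allFin q) (λ a → k Fin.zero a * P)
    ≈⟨ Σl-*ʳ (allFin q) P (k Fin.zero) ⟩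
      Σl (allFin q) (k Fin.zero) * P
    ≡⟨ cong (_* P) (Σl-tabulate (λ a → a) (k Fin.zero)) ⟩
      sum (k Fin.zero) * P
    ∎
    where
    P : Carrier
    P = product (λ i → sum (k (Fin.suc i)))

  pow-sum : ∀ (a : Carrier) {A : Set} {n} (g : A → ℕ) (f : Fin n → A) →
            a ^ foldr (λ z s → g z ℕ.+ s) 0 (tabulate f) ≈ product (λ i → a ^ g (f i))
  pow-sum a {n = zero}  g f = ≈-refl
  pow-sum a {n = suc n} g f = trans (^-homo-* a (g (f Fin.zero)) _) (*-congˡ (pow-sum a g (f ∘ Fin.suc)))

  -- Weight monomials as products of coordinate factors.  At a coordinate in
  -- the index set (p) the factor is a or b according as the coordinate is zero
  -- or not (r); off the index set it is 1.
  monomial : Carrier → Carrier → Bool → Bool → Carrier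
  monomial a b true  false = a
  monomial a b true  true  = b
  monomial a b false _     = 1#

  monomial-product : ∀ {n} (a b : Carrier) (p r : Fin n → Bool) →
                     product (λ i → monomial a b (p i) (r i))
                       ≈ a ^ (count p ∸ count (λ i → p i ∧ r i)) * b ^ count (λ i → p i ∧ r i)
  monomial-product {zero}  a b p r = sym (*-identityˡ 1#)
  monomial-product {suc n} a b p r with p Fin.zero | r Fin.zero | monomial-product a b (p ∘ Fin.suc) (r ∘ Fin.suc)
  ... | true  | false | ih = trans (*-congˡ ih) (trans (sym (*-assoc a _ _))
                                (*-congʳ (^-congʳ a (≡.sym (ℕ.+-∸-assoc 1 (count-∧-≤ (p ∘ Fin.suc) (r ∘ Fin.suc)))))))
  ... | true  | true  | ih = trans (*-congˡ ih) (x∙yz≈y∙xz b _ _)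
  ... | false | _     | ih = trans (*-identityˡ _) ih

  guard-*ˡ : ∀ (B : Bool) (a u : Carrier) → a * (if B then u else 0#) ≈ (if B then a * u else 0#)
  guard-*ˡ true  a u = ≈-refl
  guard-*ˡ false a u = zeroʳ a

  product-guarded : ∀ {n} (t : Fin n → Bool) (g : Fin n → Carrier) →
                    product (λ i → if t i then g i else 0#) ≈ (if every t then product g else 0#)
  product-guarded {zero}  t g = ≈-refl
  product-guarded {suc n} t g with t Fin.zero
  ... | true  = trans (*-congˡ (product-guarded (t ∘ Fin.suc) (g ∘ Fin.suc))) (guard-*ˡ (every (t ∘ Fin.suc)) (g Fin.zero) _)
  ... | false = zeroˡ _

  admissible-monomial : ∀ {n} (a b : Carrier) (p r : Fin n → Bool) →
                        (if every (λ i → admissible (p i) (r i)) then b ^ count r * a ^ (count p ∸ count r) else 0#)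
                          ≈ product (λ i → if admissible (p i) (r i) then monomial a b (p i) (r i) else 0#)
  admissible-monomial {n} a b p r = trans (guarded (every adm) ≡.refl) (sym (product-guarded adm _))
    where
    adm : Fin n → Bool
    adm i = admissible (p i) (r i)
    guarded : ∀ B → every adm ≡ B →
              (if B then b ^ count r * a ^ (count p ∸ count r) else 0#)
                ≈ (if B then product (λ i → monomial a b (p i) (r i)) else 0#)
    guarded true  all-adm = trans (*-comm _ _) (sym (trans (monomial-product a b p r)
                              (*-cong (^-congʳ a (cong (count p ∸_) supp)) (^-congʳ b supp))))
      where
      supp : count (λ i → p i ∧ r i) ≡ count r
      supp = count-admissible p r all-adm
    guarded false _ = ≈-refl

  1^n≈1 : ∀ n → 1# ^ n ≈ 1#
  1^n≈1 zero    = ≈-refl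
  1^n≈1 (suc n) = trans (*-identityˡ _) (1^n≈1 n)

  telescope : ∀ a b c → (a - c) + (b - a) ≈ b - c
  telescope a b c = begin
      (a - c) + (b - a)      ≈⟨ +-comm _ _ ⟩
      (b - a) + (a - c)      ≈⟨ +-assoc b (- a) _ ⟩
      b + (- a + (a - c))    ≈⟨ +-congˡ (sym (+-assoc (- a) a (- c))) ⟩
      b + ((- a + a) - c)    ≈⟨ +-congˡ (trans (+-congʳ (-‿inverseˡ a)) (+-identityˡ (- c))) ⟩
      b - c                  ∎

  a+[b-a]≈b : ∀ a b → a + (b - a) ≈ b
  a+[b-a]≈b a b = trans (+-congˡ (+-comm b (- a))) (trans (sym (+-assoc a (- a) b))
                    (trans (+-congʳ (-‿inverseʳ a)) (+-identityˡ b)))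

  shift : ∀ u v t → u + t * v ≈ (u - v) + (1# + t) * v
  shift u v t = begin
      u + t * v              ≈⟨ +-congʳ (sym (trans (+-assoc u (- v) v) (trans (+-congˡ (-‿inverseˡ v)) (+-identityʳ u)))) ⟩
      ((u - v) + v) + t * v  ≈⟨ +-assoc _ v _ ⟩
      (u - v) + (v + t * v)  ≈⟨ +-congˡ (sym (trans (distribʳ v 1# t) (+-congʳ (*-identityˡ v)))) ⟩
      (u - v) + (1# + t) * v ∎

  ×≈×1* : ∀ n a → n × a ≈ (n × 1#) * a
  ×≈×1* n a = sym (trans (×-assoc-* n 1# a) (×-congʳ n (*-identityˡ a)))

  cancel-powers : ∀ {u v} → u * v ≈ 1# → ∀ n a b → v ^ n * (a * (u ^ n * b)) ≈ a * b
  cancel-powers {u} {v} uv≈1 n a b = begin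
      v ^ n * (a * (u ^ n * b))  ≈⟨ x∙yz≈y∙xz _ a _ ⟩
      a * (v ^ n * (u ^ n * b))  ≈⟨ *-congˡ (sym (*-assoc _ _ b)) ⟩
      a * ((v ^ n * u ^ n) * b)  ≈⟨ *-congˡ (*-congʳ vⁿuⁿ≈1) ⟩
      a * (1# * b)               ≈⟨ *-congˡ (*-identityˡ b) ⟩
      a * b                      ∎
    where
    vⁿuⁿ≈1 : v ^ n * u ^ n ≈ 1#
    vⁿuⁿ≈1 = trans (sym (^-distrib-* v u n)) (trans (^-congˡ n (trans (*-comm v u) uv≈1)) (1^n≈1 n))

  geometric-sum : ∀ n w → (w - 1#) * sum (λ (b : Fin n) → w ^ toℕ b) ≈ w ^ n - 1#
  geometric-sum zero    w = trans (zeroʳ _) (sym (-‿inverseʳ 1#))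
  geometric-sum (suc n) w = begin
      (w - 1#) * (1# + sum (λ (b : Fin n) → w * w ^ toℕ b))
    ≈⟨ *-congˡ (+-congˡ (sym (*-distribˡ-sum w (λ (b : Fin n) → w ^ toℕ b)))) ⟩
      (w - 1#) * (1# + w * G)
    ≈⟨ distribˡ _ _ _ ⟩
      (w - 1#) * 1# + (w - 1#) * (w * G)
    ≈⟨ +-cong (*-identityʳ _) (x∙yz≈y∙xz _ w G) ⟩
      (w - 1#) + w * ((w - 1#) * G)
    ≈⟨ +-congˡ (*-congˡ (geometric-sum n w)) ⟩
      (w - 1#) + w * (w ^ n - 1#)
    ≈⟨ +-congˡ (trans (x[y-z]≈xy-xz w _ _) (+-congˡ (-‿cong (*-identityʳ w)))) ⟩
      (w - 1#) + (w ^ suc n - w)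
    ≈⟨ telescope w _ 1# ⟩
      w ^ suc n - 1#
    ∎
    where G = sum (λ (b : Fin n) → w ^ toℕ b)

  geometric-vanishes : (∀ a b → a * b ≈ 0# → (a ≈ 0#) ⊎ (b ≈ 0#)) →
                       ∀ n w → w ^ n ≈ 1# → ¬ (w ≈ 1#) → sum (λ (b : Fin n) → w ^ toℕ b) ≈ 0#
  geometric-vanishes integral n w wⁿ≈1 w≉1
    with integral (w - 1#) _ (trans (geometric-sum n w) (trans (+-congʳ wⁿ≈1) (-‿inverseʳ 1#)))
  ... | inj₁ w-1≈0 = ⊥-elim (w≉1 (x∙y⁻¹≈ε⇒x≈y w 1# w-1≈0))
  ... | inj₂ sum≈0 = sum≈0

  pow-multiple : ∀ {a} q → a ^ q ≈ 1# → ∀ k → a ^ (q ℕ.* k) ≈ 1#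
  pow-multiple {a} q aᵠ≈1 k = trans (sym (^-assocʳ a q k)) (trans (^-congˡ k aᵠ≈1) (1^n≈1 k))

  pow-congruent : ∀ {a} q → a ^ q ≈ 1# → ∀ {m m′} k k′ → m ℕ.+ q ℕ.* k ≡ m′ ℕ.+ q ℕ.* k′ → a ^ m ≈ a ^ m′
  pow-congruent {a} q aᵠ≈1 {m} {m′} k k′ eq =
    trans (sym (drop-multiple m k)) (trans (^-congʳ a eq) (drop-multiple m′ k′))
    where
    drop-multiple : ∀ m k → a ^ (m ℕ.+ q ℕ.* k) ≈ a ^ m
    drop-multiple m k = trans (^-homo-* a m _) (trans (*-congˡ (pow-multiple q aᵠ≈1 k)) (*-identityʳ _))

  -- A primitive q-th root of unity ξ in an integral domain, q = suc q′.
  -- Its conjugate ζ = ξ^(q-1) = ξ⁻¹ gives the characters χ(b,c) = ζ^(bc) of 𝔽_q.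
  module RootOfUnity (integral : ∀ a b → a * b ≈ 0# → (a ≈ 0#) ⊎ (b ≈ 0#))
                     (q′ : ℕ) (ξ : Carrier) (ξ^q≈1 : ξ ^ suc q′ ≈ 1#)
                     (ξ-primitive : ∀ k → 1 ≤ k → k < suc q′ → ¬ (ξ ^ k ≈ 1#)) where

    q : ℕ
    q = suc q′

    ζ : Carrier
    ζ = ξ ^ q′

    ζ^q≈1 : ζ ^ q ≈ 1#
    ζ^q≈1 = trans (^-assocʳ ξ q′ q) (trans (^-congʳ ξ (ℕ.*-comm q′ q)) (pow-multiple q ξ^q≈1 q′))

    ζ^k≈ξ^[q-k] : ∀ k → k ≤ q → ζ ^ k ≈ ξ ^ (q ∸ k)
    ζ^k≈ξ^[q-k] k k≤q = trans (^-assocʳ ξ q′ k) (pow-congruent q ξ^q≈1 {q′ ℕ.* k} {q ∸ k} 1 k (conjugate-exponent q′ k k≤q))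

    ζ-primitive : ∀ k → 1 ≤ k → k < q → ¬ (ζ ^ k ≈ 1#)
    ζ-primitive k 1≤k k<q ζᵏ≈1 =
      ξ-primitive (q ∸ k) (ℕ.m<n⇒0<n∸m k<q) (ℕ.∸-monoʳ-< 1≤k (ℕ.<⇒≤ k<q)) (trans (sym (ζ^k≈ξ^[q-k] k (ℕ.<⇒≤ k<q))) ζᵏ≈1)

    χ : Fin q → Fin q → Carrier
    χ b c = ζ ^ (toℕ b ℕ.* toℕ c)

    kernel-factorises : ∀ {n} (β γ : Vec𝔽 q n) → ξ ^ (q ∸ inner q β γ) ≈ product (λ i → χ (β i) (γ i))
    kernel-factorises {n} β γ = begin
        ξ ^ (q ∸ M % q)                ≈⟨ sym (ζ^k≈ξ^[q-k] (M % q) (ℕ.<⇒≤ (m%n<n M q))) ⟩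
        ζ ^ (M % q)                    ≈⟨ sym (pow-congruent q ζ^q≈1 {M} {M % q} 0 (M / q) (residue-congruence q M)) ⟩
        ζ ^ M                          ≈⟨ pow-sum ζ (λ i → toℕ (β i) ℕ.* toℕ (γ i)) (λ i → i) ⟩
        product (λ i → χ (β i) (γ i))  ∎
      where
      M : ℕ
      M = foldr (λ i s → toℕ (β i) ℕ.* toℕ (γ i) ℕ.+ s) 0 (allFin n)

    χ-sum-zero : sum (λ b → χ b Fin.zero) ≈ q × 1#
    χ-sum-zero = trans (sum-cong-≋ {q} {y = λ _ → 1#} (λ b → ^-congʳ ζ (ℕ.*-zeroʳ (toℕ b)))) (sum-replicate q)

    χ-sum-nonzero : ∀ c → sum (λ b → χ b (Fin.suc c)) ≈ 0#
    χ-sum-nonzero c = trans (sum-cong-≋ χ≈wᵇ) (geometric-vanishes integral q w wᵠ≈1 (ζ-primitive k (s≤s z≤n) (toℕ<n (Fin.suc c))))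
      where
      k : ℕ
      k = suc (toℕ c)
      w : Carrier
      w = ζ ^ k
      χ≈wᵇ : ∀ b → χ b (Fin.suc c) ≈ w ^ toℕ b
      χ≈wᵇ b = trans (^-congʳ ζ (ℕ.*-comm (toℕ b) k)) (sym (^-assocʳ ζ k (toℕ b)))
      wᵠ≈1 : w ^ q ≈ 1#
      wᵠ≈1 = trans (^-assocʳ ζ k q) (trans (^-congʳ ζ (ℕ.*-comm k q)) (pow-multiple q ζ^q≈1 k))

    module Transform (x y : Carrier) where

      U V : Carrier
      U = x + q′ × y
      V = x - y

      U-V≈q×y : U - V ≈ q × y
      U-V≈q×y = begin
          (x + q′ × y) - (x - y)      ≈⟨ +-congˡ (⁻¹-anti-homo‿- x y) ⟩
          (x + q′ × y) + (y - x)      ≈⟨ +-congʳ (+-comm x _) ⟩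
          (q′ × y + x) + (y - x)      ≈⟨ +-assoc _ x _ ⟩
          q′ × y + (x + (y - x))      ≈⟨ +-congˡ (a+[b-a]≈b x y) ⟩
          q′ × y + y                  ≈⟨ +-comm _ y ⟩
          y + q′ × y                  ∎

      -- The coordinate factor of the Γ_I-term of g^I_f: x or y on I (zero or
      -- nonzero coordinate); off I, 1 at a zero coordinate and 0 otherwise.
      local-factor : Bool → Fin q → Carrier
      local-factor s c = if admissible s (nz c) then monomial x y s (nz c) else 0#

      coordinate-transform : ∀ s c → sum (λ b → χ b c * monomial U V s (nz b)) ≈ (q × 1#) * local-factor s c
      coordinate-transform false c = trans (sum-cong-≋ (λ b → *-identityʳ (χ b c))) (orthogonal c)
        where
        orthogonal : ∀ c → sum (λ b → χ b c) ≈ (q × 1#) * local-factor false c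
        orthogonal Fin.zero    = trans χ-sum-zero (sym (*-identityʳ _))
        orthogonal (Fin.suc c) = trans (χ-sum-nonzero c) (sym (zeroʳ _))
      coordinate-transform true c = begin
          1# * U + sum (λ b → χ (Fin.suc b) c * V)
        ≈⟨ +-cong (*-identityˡ U) (sym (*-distribʳ-sum V (λ b → χ (Fin.suc b) c))) ⟩
          U + T * V
        ≈⟨ shift U V T ⟩
          (U - V) + (1# + T) * V
        ≈⟨ +-congʳ U-V≈q×y ⟩
          q × y + sum (λ b → χ b c) * V
        ≈⟨ on-I c ⟩
          (q × 1#) * local-factor true c
        ∎
        where
        T : Carrier
        T = sum (λ b → χ (Fin.suc b) c)
        on-I : ∀ c → q × y + sum (λ b → χ b c) * V ≈ (q × 1#) * local-factor true c
        on-I Fin.zero = begin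
            q × y + sum (λ b → χ b Fin.zero) * V  ≈⟨ +-congˡ (trans (*-congʳ χ-sum-zero) (sym (×≈×1* q V))) ⟩
            q × y + q × V                         ≈⟨ sym (×-distrib-+ y V q) ⟩
            q × (y + (x - y))                     ≈⟨ ×-congʳ q (a+[b-a]≈b y x) ⟩
            q × x                                 ≈⟨ ×≈×1* q x ⟩
            (q × 1#) * x                          ∎
        on-I (Fin.suc c) = trans (+-congˡ (trans (*-congʳ (χ-sum-nonzero c)) (zeroˡ V))) (trans (+-identityʳ _) (×≈×1* q y))

      module _ {n : ℕ} (I : Subset n) where

        weight-monomial : Vec𝔽 q n → Carrier
        weight-monomial β = product (λ i → monomial U V (inI I i) (nz (β i)))

        local-term : Vec𝔽 q n → Carrier
        local-term γ = product (λ i → local-factor (inI I i) (γ i))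

        weight-monomial≈ : ∀ β → U ^ (∣ I ∣ ∸ wtI I β) * V ^ wtI I β ≈ weight-monomial β
        weight-monomial≈ β
          rewrite card≡count I | length-filter-tabulate (λ i → inI I i ∧ nz (β i)) (λ i → i) =
          sym (monomial-product U V (inI I) (λ i → nz (β i)))

        local-term≈ : ∀ (f : Vec𝔽 q n → Carrier) γ →
                      (if inΓ I γ then f γ * y ^ wt γ * x ^ (∣ I ∣ ∸ wt γ) else 0#) ≈ f γ * local-term γ
        local-term≈ f γ
          rewrite inΓ≡every I γ | card≡count I | length-filter-tabulate (λ i → nz (γ i)) (λ i → i) =
          trans (guarded-assoc (every (λ i → admissible (inI I i) (nz (γ i)))))
                (*-congˡ (admissible-monomial x y (inI I) (λ i → nz (γ i))))
          where
          guarded-assoc : ∀ B {u v} → (if B then f γ * u * v else 0#) ≈ f γ * (if B then u * v else 0#)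
          guarded-assoc true  = *-assoc (f γ) _ _
          guarded-assoc false = sym (zeroʳ (f γ))

        transform-weight-monomial : ∀ γ → Σ𝔽 q n (λ β → ξ ^ (q ∸ inner q β γ) * weight-monomial β)
                                            ≈ (q × 1#) ^ n * local-term γ
        transform-weight-monomial γ = begin
            Σ𝔽 q n (λ β → ξ ^ (q ∸ inner q β γ) * weight-monomial β)
          ≈⟨ Σl-cong (allVecs q n) (λ β → trans (*-congʳ (kernel-factorises β γ)) (sym (product-distrib-* _ (weight-factors β)))) ⟩
            Σ𝔽 q n (λ β → product (λ i → χ (β i) (γ i) * monomial U V (inI I i) (nz (β i))))
          ≈⟨ Σ𝔽-product q n (λ i b → χ b (γ i) * monomial U V (inI I i) (nz b)) ⟩
            product (λ i → sum (λ b → χ b (γ i) * monomial U V (inI I i) (nz b)))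
          ≈⟨ product-cong (λ i → coordinate-transform (inI I i) (γ i)) ⟩
            product (λ i → (q × 1#) * local-factor (inI I i) (γ i))
          ≈⟨ product-scale (q × 1#) (λ i → local-factor (inI I i) (γ i)) ⟩
            (q × 1#) ^ n * local-term γ
          ∎
          where
          weight-factors : Vec𝔽 q n → Fin n → Carrier
          weight-factors β i = monomial U V (inI I i) (nz (β i))

        local-MacWilliams : (f : Vec𝔽 q n → Carrier) (qinv : Carrier) → (q × 1#) * qinv ≈ 1# →
                            localWE q n I f x y
                              ≈ qinv ^ n * Σ𝔽 q n (λ β → fourier ξ q n f β * U ^ (∣ I ∣ ∸ wtI I β) * V ^ wtI I β)
        local-MacWilliams f qinv q*qinv≈1 = begin
            localWE q n I f x y
          ≈⟨ Σl-cong 𝔽ⁿ (local-term≈ f) ⟩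
            Σ𝔽 q n (λ γ → f γ * local-term γ)
          ≈⟨ sym (trans (sym (Σl-*ˡ 𝔽ⁿ (qinv ^ n) _)) (Σl-cong 𝔽ⁿ (λ γ → cancel-powers q*qinv≈1 n (f γ) (local-term γ)))) ⟩
            qinv ^ n * Σ𝔽 q n (λ γ → f γ * ((q × 1#) ^ n * local-term γ))
          ≈⟨ *-congˡ (Σl-cong 𝔽ⁿ (λ γ → *-congˡ (sym (transform-weight-monomial γ)))) ⟩
            qinv ^ n * Σ𝔽 q n (λ γ → f γ * Σ𝔽 q n (λ β → ξ ^ (q ∸ inner q β γ) * weight-monomial β))
          ≈⟨ *-congˡ (sym (Σl-transpose 𝔽ⁿ 𝔽ⁿ f (λ β γ → ξ ^ (q ∸ inner q β γ)) weight-monomial)) ⟩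
            qinv ^ n * Σ𝔽 q n (λ β → fourier ξ q n f β * weight-monomial β)
          ≈⟨ *-congˡ (Σl-cong 𝔽ⁿ (λ β → trans (*-congˡ (sym (weight-monomial≈ β))) (sym (*-assoc _ _ _)))) ⟩
            qinv ^ n * Σ𝔽 q n (λ β → fourier ξ q n f β * U ^ (∣ I ∣ ∸ wtI I β) * V ^ wtI I β)
          ∎
          where
          𝔽ⁿ : List (Vec𝔽 q n)
          𝔽ⁿ = allVecs q n

lemma2 : {c ℓ : Level} (R : CommutativeRing c ℓ) →
         let open CommutativeRing R in
         let open Over R in
         ¬ (1# ≈ 0#) →
         (∀ a b → a * b ≈ 0# → (a ≈ 0#) ⊎ (b ≈ 0#)) →
         (q n : ℕ) .{{_ : NonZero q}} → 2 ≤ q → 1 ≤ n →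
         (ξ : Carrier) → ξ ^ q ≈ 1# → (∀ k → 1 ≤ k → k < q → ¬ (ξ ^ k ≈ 1#)) →
         (qinv : Carrier) → (q × 1#) * qinv ≈ 1# →
         (I : Subset n) (f : Vec𝔽 q n → Carrier) (x y : Carrier) →
         localWE q n I f x y ≈
           (qinv ^ n) * Σ𝔽 q n (λ β → fourier ξ q n f β
                                        * ((x + (q ∸ 1) × y) ^ (∣ I ∣ ∸ wtI I β))
                                        * ((x - y) ^ wtI I β))
lemma2 R _ _ zero _ () _ _ _ _ _ _ _ _ _ _
lemma2 R _ integral (suc q′) n _ _ ξ ξ^q≈1 ξ-primitive qinv q*qinv≈1 I f x y =
  RootOfUnity.Transform.local-MacWilliams R integral q′ ξ ξ^q≈1 ξ-primitive x y I f qinv q*qinv≈1
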